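{- Let $\mathcal{L}$ be a conditional oriented matroid on a finite, linearly ordered ground set $\mathcal{I}$, let $i$ be the maximal element of $\mathcal{I}$, and suppose $i$ is not a coloop. Let $\mathcal{N},\mathcal{N}',\mathcal{N}''$ be the collections of NBC sets of $\mathcal{L}$, of the deletion $\mathcal{L}'$ and of the contraction $\mathcal{L}''$ at $i$ (the latter two with respect to the induced order on $\mathcal{I}\setminus\{i\}$). Then $$\mathcal{N}'=\{S\in\mathcal{N}\mid i\notin S\}\quad\text{and}\quad\{S''\cup\{i\}\mid S''\in\mathcal{N}''\}=\{S\in\mathcal{N}\mid i\in S\}.$$ In particular $|\mathcal{N}|=|\mathcal{N}'|+|\mathcal{N}''|$.
   Context: Signed sets $X=(X^+,X^-)$ on a finite set (disjoint subsets), support $\underline{X}=X^+\cup X^-$, $X_j\in\{+,-,0\}$, $-X=(X^-,X^+)$, $\operatorname{Sep}(X,Y)=\{j\mid X_j=-Y_j\ne0\}$, $(X\circ Y)_j=X_j$ if $X_j\ne0$ else $Y_j$. A conditional oriented matroid is a (possibly empty) set $\mathcal{L}$ of signed sets with (FS) $X,Y\in\mathcal{L}\Rightarrow X\circ-Y\in\mathcal{L}$ and (SE) for $X,Y\in\mathcal{L}$, $j\in\operatorname{Sep}(X,Y)$ there is $Z\in\mathcal{L}$ with $Z_j=0$ and $Z_k=(X\circ Y)_k$ for $k\notin\operatorname{Sep}(X,Y)$. A coloop is an element $i$ with $X_i=0$ for all $X\in\mathcal{L}$. Deletion $\mathcal{L}'=\{\pi(X)\mid X\in\mathcal{L}\}$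 and contraction $\mathcal{L}''=\{\pi(X)\mid X\in\mathcal{L},X_i=0\}$, where $\pi$ forgets coordinate $i$. A circuit of a conditional oriented matroid is a signed set $X$ with $X\circ Y\ne Y$ for every covector $Y$, support-minimal with this property. For $X$ with nonempty support, $\mathring{X}:=\underline{X}\setminus\{\min\underline{X}\}$. An NBC set is a subset $S$ of the ground set such that no circuit has support contained in $S$, and $\mathring{X}\not\subset S$ whenever $X$ and $-X$ are both circuits with nonempty support. -}

module Defs where

open import Data.Nat using (ℕ; zero; suc; _+_)
open import Data.Fin using (Fin; _<_)
open import Data.Bool using (Bool; true; false)
open import Data.Vec using (Vec; []; _∷_; lookup; zipWith; map)
open import Data.Fin.Subset using (Subset; _∈_)
open import Data.List using (List; []; _∷_; length; filter; concatMap) renaming (map to mapL)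
open import Data.Product using (Σ; ∃; _×_; _,_)
open import Relation.Binary.PropositionalEquality using (_≡_; _≢_)
open import Relation.Nullary using (¬_)
open import Relation.Unary using (Decidable)

-- Signs and signed sets on the ground set Fin n (linearly ordered by the
-- natural order of Fin n).  A signed set X = (X⁺,X⁻) is encoded by its
-- sign vector (X_j)_j ∈ {+,-,0}^n.
data Sign : Set where
  ⊕ ⊖ ∅ : Sign

SignedSet : ℕ → Set
SignedSet n = Vec Sign n

negS : Sign → Sign
negS ⊕ = ⊖
negS ⊖ = ⊕
negS ∅ = ∅

neg : ∀ {n} → SignedSet n → SignedSet n
neg = map negS

compS : Sign → Sign → Sign
compS ∅ y = y
compS x y = x

_∘ₛ_ : ∀ {n} → SignedSet n → SignedSet n → SignedSet n
_∘ₛ_ = zipWith compS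

_⟨_⟩ : ∀ {n} → SignedSet n → Fin n → Sign
X ⟨ j ⟩ = lookup X j

InSep : ∀ {n} → SignedSet n → SignedSet n → Fin n → Set
InSep X Y j = (X ⟨ j ⟩ ≡ negS (Y ⟨ j ⟩)) × (X ⟨ j ⟩ ≢ ∅)

Family : ℕ → Set₁
Family n = SignedSet n → Set

record IsCOM {n} (L : Family n) : Set where
  field
    FS : ∀ X Y → L X → L Y → L (X ∘ₛ neg Y)
    SE : ∀ X Y → L X → L Y → ∀ j → InSep X Y j →
         Σ (SignedSet n) λ Z → L Z × (Z ⟨ j ⟩ ≡ ∅) ×
           (∀ k → ¬ InSep X Y k → Z ⟨ k ⟩ ≡ (X ∘ₛ Y) ⟨ k ⟩)

IsColoop : ∀ {n} → Family n → Fin n → Set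
IsColoop L i = ∀ X → L X → X ⟨ i ⟩ ≡ ∅

π : ∀ {A : Set} {n} → Vec A (suc n) → Vec A n
π {n = zero} _ = []
π {n = suc n} (x ∷ xs) = x ∷ π xs

-- Deletion and contraction at the maximal element (the last coordinate).
deletion : ∀ {n} → Family (suc n) → Family n
deletion L X' = Σ (SignedSet _) λ X → L X × π X ≡ X'

lastSign : ∀ {n} → SignedSet (suc n) → Sign
lastSign {zero} (x ∷ []) = x
lastSign {suc n} (x ∷ xs) = lastSign xs

contraction : ∀ {n} → Family (suc n) → Family n
contraction L X' = Σ (SignedSet _) λ X → L X × lastSign X ≡ ∅ × π X ≡ X'

Avoids : ∀ {n} → Family n → SignedSet n → Set
Avoids L X = ∀ Y → L Y → (X ∘ₛ Y) ≢ Y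

_⊑_ : ∀ {n} → SignedSet n → SignedSet n → Set
X ⊑ Y = ∀ j → X ⟨ j ⟩ ≢ ∅ → Y ⟨ j ⟩ ≢ ∅

_⊏_ : ∀ {n} → SignedSet n → SignedSet n → Set
X ⊏ Y = X ⊑ Y × ¬ (Y ⊑ X)

IsCircuit : ∀ {n} → Family n → SignedSet n → Set
IsCircuit L X = Avoids L X × (∀ Z → Z ⊏ X → ¬ Avoids L Z)

SuppIn : ∀ {n} → SignedSet n → Subset n → Set
SuppIn X S = ∀ j → X ⟨ j ⟩ ≢ ∅ → j ∈ S

-- X̊ = underline(X) \ {min underline(X)} ⊆ S : every support element that is
-- not the minimum of the support (i.e. has a smaller support element) lies in S.
RingIn : ∀ {n} → SignedSet n → Subset n → Set
RingIn X S = ∀ j → X ⟨ j ⟩ ≢ ∅ → (Σ (Fin _) λ k → k < j × X ⟨ k ⟩ ≢ ∅) → j ∈ S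

NonEmptySupp : ∀ {n} → SignedSet n → Set
NonEmptySupp X = ∃ λ j → X ⟨ j ⟩ ≢ ∅

IsNBC : ∀ {n} → Family n → Subset n → Set
IsNBC L S =
  (∀ X → IsCircuit L X → ¬ SuppIn X S) ×
  (∀ X → IsCircuit L X → IsCircuit L (neg X) → NonEmptySupp X → ¬ RingIn X S)

allSubsets : ∀ n → List (Subset n)
allSubsets zero = [] ∷ []
allSubsets (suc n) = concatMap (λ S → (false ∷ S) ∷ (true ∷ S) ∷ []) (allSubsets n)

count : ∀ {n} {P : Subset n → Set} → Decidable P → ℕ
count {n} d = length (filter d (allSubsets n))

{-# OPTIONS --safe #-}
-- Because i is maximal, a broken circuit X̊ contains i unless X vanishes at i, and a circuit
-- pair ±X cannot be supported on {i} alone since i is not a coloop. So the circuits that matter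
-- for NBC sets missing i are the circuits of L vanishing at i, which are those of the deletion.
--
-- For the contraction, an avoided X ∷ʳ x of L restricts to an avoided X of L″, and X is covered
-- in L″ as soon as X ∷ʳ ⊕ and X ∷ʳ ⊖ are covered in L (eliminate i). Broken circuits are
-- transferred with one more idea: if X̊ lies in an NBC set it is independent, so by strong
-- elimination every sign pattern on X̊ is realized by a covector. A covector vanishing on X̊
-- either vanishes at min X too, and then some circuit pair below X has its broken circuit in X̊,
-- or it fixes the sign at min X, and composing it with realizations of ±X covers X or -X.
-- The count follows by splitting the subsets of the ground set at i.
module Submission where

open import Defs
open import Data.Nat using (ℕ; suc; _+_)
open import Data.Fin using (Fin; fromℕ)
open import Data.Vec using (_∷ʳ_)
open import Data.Bool using (true; false)
open import Data.Fin.Subset using (Subset; _∈_; _∉_)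
open import Data.Product using (Σ; _×_)
open import Relation.Binary.PropositionalEquality using (_≡_)
open import Relation.Unary using (Decidable)
open import Function.Bundles using (_⇔_)
open import Relation.Nullary using (¬_)

open import Level using (0ℓ)
open import Data.Bool using (Bool; if_then_else_)
import Data.Bool.Properties as Boolₚ
import Algebra.Properties.CommutativeSemigroup as CommutativeSemigroupProperties
open import Data.Empty using (⊥)
open import Data.Fin as Fin using (_<_; inject₁; inject; fromℕ<)
import Data.Fin.Relation.Unary.Top as Top
import Data.Fin.Properties as Finₚ
import Data.Nat as ℕ
import Data.Nat.Properties as ℕₚ
open import Data.Fin.Subset using (∣_∣; _⊂_)
open import Data.Fin.Subset.Properties using (p⊂q⇒∣p∣<∣q∣)
open import Data.Nat.Induction using (<-wellFounded)
open import Data.Product using (∃; _,_; proj₁; proj₂)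
open import Data.Sum using (_⊎_; inj₁; inj₂; [_,_]′)
open import Data.List using (List; []; _∷_; allFin; length; filter; concatMap)
import Data.List.Properties as Listₚ
open import Data.List.Membership.Propositional using () renaming (_∈_ to _∈ˡ_)
open import Data.List.Membership.Propositional.Properties using (∈-allFin)
import Data.List.Relation.Unary.Any as Any
open import Data.Vec as Vec using (Vec; []; _∷_; lookup; map; _[_]≔_)
import Data.Vec.Properties as Vecₚ
open import Effect.Monad using (RawMonad)
open import Function using (_∘_; id; case_of_)
open import Function.Bundles using (mk⇔; Equivalence)
open Equivalence using (to; from)
open import Induction.WellFounded using (Acc; acc; WellFounded; module Subrelation)
open import Relation.Binary.Construct.On as On using ()
open import Relation.Binary.Definitions using (DecidableEquality)
open import Relation.Binary.PropositionalEquality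
  using (_≢_; refl; sym; trans; cong; cong₂; subst; subst₂; module ≡-Reasoning)
open import Relation.Nullary using (Dec; yes; no; does; ¬?; contradiction)
open import Relation.Nullary.Decidable using (decidable-stable; _→-dec_; _×-dec_)
open import Relation.Nullary.Negation using (¬¬-Monad; ¬¬-map)
open import Relation.Unary using (Pred; _⊆′_)

open RawMonad (¬¬-Monad {a = 0ℓ}) using (pure; _>>=_)

private
  variable
    N : ℕ
    A B : Set
    K : Family N
    x y : Sign
    X Y Z : SignedSet N

infix 4 _≟ₛ_
_≟ₛ_ : DecidableEquality Sign
⊕ ≟ₛ ⊕ = yes refl
⊖ ≟ₛ ⊖ = yes refl
∅ ≟ₛ ∅ = yes refl
⊕ ≟ₛ ⊖ = no λ ()
⊕ ≟ₛ ∅ = no λ ()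
⊖ ≟ₛ ⊕ = no λ ()
⊖ ≟ₛ ∅ = no λ ()
∅ ≟ₛ ⊕ = no λ ()
∅ ≟ₛ ⊖ = no λ ()

negS-involutive : ∀ x → negS (negS x) ≡ x
negS-involutive ⊕ = refl
negS-involutive ⊖ = refl
negS-involutive ∅ = refl

negS-≢∅ : x ≢ ∅ → negS x ≢ ∅
negS-≢∅ {⊕} _ ()
negS-≢∅ {⊖} _ ()
negS-≢∅ {∅} x≢∅ = x≢∅

compS-≢∅ : x ≢ ∅ → compS x y ≡ x
compS-≢∅ {⊕} _ = refl
compS-≢∅ {⊖} _ = refl
compS-≢∅ {∅} x≢∅ = contradiction refl x≢∅

compS-idem : ∀ x → compS x x ≡ x
compS-idem ⊕ = refl
compS-idem ⊖ = refl
compS-idem ∅ = refl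

Opposite : Sign → Sign → Set
Opposite x y = (x ≡ negS y) × (x ≢ ∅)

Opposite-irrefl : ¬ Opposite x x
Opposite-irrefl {⊕} (() , _)
Opposite-irrefl {⊖} (() , _)
Opposite-irrefl {∅} (_ , ∅≢∅) = ∅≢∅ refl

nonzero-signs : x ≢ ∅ → y ≢ ∅ → x ≡ y ⊎ x ≡ negS y
nonzero-signs {⊕} {⊕} _ _ = inj₁ refl
nonzero-signs {⊕} {⊖} _ _ = inj₂ refl
nonzero-signs {⊖} {⊕} _ _ = inj₂ refl
nonzero-signs {⊖} {⊖} _ _ = inj₁ refl
nonzero-signs {∅} x≢∅ _ = contradiction refl x≢∅
nonzero-signs {_} {∅} _ y≢∅ = contradiction refl y≢∅

supp : SignedSet N → Pred (Fin N) 0ℓ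
supp X j = X ⟨ j ⟩ ≢ ∅

supp? : (X : SignedSet N) → Decidable (supp X)
supp? X j = ¬? (X ⟨ j ⟩ ≟ₛ ∅)

lookup-∘ₛ : ∀ (X Y : SignedSet N) j → (X ∘ₛ Y) ⟨ j ⟩ ≡ compS (X ⟨ j ⟩) (Y ⟨ j ⟩)
lookup-∘ₛ X Y j = Vecₚ.lookup-zipWith compS j X Y

lookup-neg : ∀ (X : SignedSet N) j → neg X ⟨ j ⟩ ≡ negS (X ⟨ j ⟩)
lookup-neg X j = Vecₚ.lookup-map j negS X

≡-from-lookup : ∀ {A : Set} {xs ys : Vec A N} → (∀ j → lookup xs j ≡ lookup ys j) → xs ≡ ys
≡-from-lookup {xs = xs} {ys} eq =
  trans (sym (Vecₚ.tabulate∘lookup xs)) (trans (Vecₚ.tabulate-cong eq) (Vecₚ.tabulate∘lookup ys))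

⊑-neg : (X : SignedSet N) → X ⊑ neg X
⊑-neg X j X≢∅ = subst (_≢ ∅) (sym (lookup-neg X j)) (negS-≢∅ X≢∅)

neg-⊑ : (X : SignedSet N) → neg X ⊑ X
neg-⊑ X j −X≢∅ X≡∅ = −X≢∅ (trans (lookup-neg X j) (cong negS X≡∅))

infix 4 _≤ₛ_
_≤ₛ_ : SignedSet N → SignedSet N → Set
X ≤ₛ Y = ∀ j → X ⟨ j ⟩ ≢ ∅ → Y ⟨ j ⟩ ≡ X ⟨ j ⟩

≤ₛ⇒∘ₛ≡ : X ≤ₛ Y → X ∘ₛ Y ≡ Y
≤ₛ⇒∘ₛ≡ {X = X} {Y} X≤Y = ≡-from-lookup λ j → trans (lookup-∘ₛ X Y j) (at j (X ⟨ j ⟩ ≟ₛ ∅))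
  where
  at : ∀ j → Dec (X ⟨ j ⟩ ≡ ∅) → compS (X ⟨ j ⟩) (Y ⟨ j ⟩) ≡ Y ⟨ j ⟩
  at j (yes X≡∅) rewrite X≡∅ = refl
  at j (no X≢∅) = trans (compS-≢∅ X≢∅) (sym (X≤Y j X≢∅))

∘ₛ≡⇒≤ₛ : X ∘ₛ Y ≡ Y → X ≤ₛ Y
∘ₛ≡⇒≤ₛ {X = X} {Y} eq j X≢∅ =
  trans (sym (cong (λ V → V ⟨ j ⟩) eq)) (trans (lookup-∘ₛ X Y j) (compS-≢∅ X≢∅))

≤ₛ-∘ₛ : X ≤ₛ Y → X ≤ₛ Y ∘ₛ Z
≤ₛ-∘ₛ {X = X} {Y} {Z} X≤Y j X≢∅ =
  trans (lookup-∘ₛ Y Z j) (trans (compS-≢∅ (subst (_≢ ∅) (sym (X≤Y j X≢∅)) X≢∅)) (X≤Y j X≢∅))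

avoids⇒¬≤ₛ : Avoids K X → K Y → ¬ X ≤ₛ Y
avoids⇒¬≤ₛ av KY = av _ KY ∘ ≤ₛ⇒∘ₛ≡

¬≤ₛ⇒avoids : (∀ Y → K Y → ¬ X ≤ₛ Y) → Avoids K X
¬≤ₛ⇒avoids h Y KY = h Y KY ∘ ∘ₛ≡⇒≤ₛ

¬avoids⇒covered : ¬ Avoids K X → ¬ ¬ ∃ λ Y → K Y × X ≤ₛ Y
¬avoids⇒covered ¬av none = ¬av (¬≤ₛ⇒avoids λ Y KY X≤Y → none (Y , KY , X≤Y))

sign-choice : ∀ {X : SignedSet N} {m c} → supp X m → c ≢ ∅ → X ⟨ m ⟩ ≡ c ⊎ neg X ⟨ m ⟩ ≡ c
sign-choice {X = X} {m} {c} Xm≢∅ c≢∅ with nonzero-signs Xm≢∅ c≢∅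
... | inj₁ Xm≡c = inj₁ Xm≡c
... | inj₂ Xm≡−c = inj₂ (trans (lookup-neg X m) (trans (cong negS Xm≡−c) (negS-involutive c)))

Independent : Family N → Pred (Fin N) 0ℓ → Set
Independent K U = ∀ ρ → supp ρ ⊆′ U → ¬ Avoids K ρ

compS-negS-compS-negS : ∀ x y → compS x (negS (compS x (negS y))) ≡ compS x y
compS-negS-compS-negS ⊕ y = refl
compS-negS-compS-negS ⊖ y = refl
compS-negS-compS-negS ∅ y = negS-involutive y

∘ₛ-neg-∘ₛ-neg : (X Y : SignedSet N) → X ∘ₛ neg (X ∘ₛ neg Y) ≡ X ∘ₛ Y
∘ₛ-neg-∘ₛ-neg [] [] = refl
∘ₛ-neg-∘ₛ-neg (x ∷ X) (y ∷ Y) = cong₂ _∷_ (compS-negS-compS-negS x y) (∘ₛ-neg-∘ₛ-neg X Y)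

∘ₛ-closed : IsCOM K → K X → K Y → K (X ∘ₛ Y)
∘ₛ-closed {K = K} {X = X} {Y} com KX KY =
  subst K (∘ₛ-neg-∘ₛ-neg X Y) (IsCOM.FS com X (X ∘ₛ neg Y) KX (IsCOM.FS com X Y KX KY))

-- Coordinates on which V₁ and V₂ agree are not separated, so (SE) keeps them.
elimination : IsCOM K → ∀ {V₁ V₂ j} → K V₁ → K V₂ → Opposite (V₁ ⟨ j ⟩) (V₂ ⟨ j ⟩) →
              ∃ λ Z → K Z × Z ⟨ j ⟩ ≡ ∅ × (∀ k → V₁ ⟨ k ⟩ ≡ V₂ ⟨ k ⟩ → Z ⟨ k ⟩ ≡ V₁ ⟨ k ⟩)
elimination com {V₁} {V₂} {j} K₁ K₂ opp =
  let Z , KZ , Zj≡∅ , Z≈V₁∘V₂ = IsCOM.SE com V₁ V₂ K₁ K₂ j opp in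
  Z , KZ , Zj≡∅ , λ k V₁≡V₂ → begin
    Z ⟨ k ⟩                           ≡⟨ Z≈V₁∘V₂ k (Opposite-irrefl ∘ subst (Opposite (V₁ ⟨ k ⟩)) (sym V₁≡V₂)) ⟩
    (V₁ ∘ₛ V₂) ⟨ k ⟩                  ≡⟨ lookup-∘ₛ V₁ V₂ k ⟩
    compS (V₁ ⟨ k ⟩) (V₂ ⟨ k ⟩)       ≡⟨ cong (compS (V₁ ⟨ k ⟩)) (sym V₁≡V₂) ⟩
    compS (V₁ ⟨ k ⟩) (V₁ ⟨ k ⟩)       ≡⟨ compS-idem (V₁ ⟨ k ⟩) ⟩
    V₁ ⟨ k ⟩                          ∎
  where open ≡-Reasoning

-- If -X ≤ₛ V then X ≤ₛ Y₀ ∘ (-V).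
avoids-neg : IsCOM K → ∀ {Y₀} → K Y₀ → (∀ j → supp X j → Y₀ ⟨ j ⟩ ≡ ∅) → Avoids K X → Avoids K (neg X)
avoids-neg {X = X} com {Y₀} KY₀ Y₀≈∅ av = ¬≤ₛ⇒avoids λ V KV −X≤V →
  avoids⇒¬≤ₛ av (IsCOM.FS com Y₀ V KY₀ KV) λ j X≢∅ → begin
    (Y₀ ∘ₛ neg V) ⟨ j ⟩              ≡⟨ lookup-∘ₛ Y₀ (neg V) j ⟩
    compS (Y₀ ⟨ j ⟩) (neg V ⟨ j ⟩)   ≡⟨ cong (λ y → compS y (neg V ⟨ j ⟩)) (Y₀≈∅ j X≢∅) ⟩
    neg V ⟨ j ⟩                      ≡⟨ lookup-neg V j ⟩
    negS (V ⟨ j ⟩)                   ≡⟨ cong negS (−X≤V j (⊑-neg X j X≢∅)) ⟩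
    negS (neg X ⟨ j ⟩)               ≡⟨ cong negS (lookup-neg X j) ⟩
    negS (negS (X ⟨ j ⟩))            ≡⟨ negS-involutive (X ⟨ j ⟩) ⟩
    X ⟨ j ⟩                          ∎
  where open ≡-Reasoning

avoids⇒nonempty : Avoids K X → K Y → NonEmptySupp X
avoids⇒nonempty {X = X} av KY =
  Finₚ.¬∀⟶∃¬ _ (λ j → X ⟨ j ⟩ ≡ ∅) (λ j → X ⟨ j ⟩ ≟ₛ ∅)
    λ X≡∅ → avoids⇒¬≤ₛ av KY λ j X≢∅ → contradiction (X≡∅ j) X≢∅

¬coloop⇒covector : ∀ {i} → ¬ IsColoop K i → ¬ ¬ ∃ λ V → K V × supp V i
¬coloop⇒covector {i = i} ¬coloop none =
  ¬coloop λ V KV → decidable-stable (V ⟨ i ⟩ ≟ₛ ∅) λ V≢∅ → none (V , KV , V≢∅)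

avoided-pair-at⇒coloop : ∀ {i} → Avoids K X → Avoids K (neg X) → (∀ j → supp X j → j ≡ i) → IsColoop K i
avoided-pair-at⇒coloop {X = X} {i = i} av av⁻ at Y KY =
  decidable-stable (Y ⟨ i ⟩ ≟ₛ ∅) λ Y≢∅ → case X ⟨ i ⟩ ≟ₛ ∅ of λ where
    (yes X≡∅) → avoids⇒¬≤ₛ av KY λ j X≢∅ → contradiction (subst (λ k → X ⟨ k ⟩ ≡ ∅) (sym (at j X≢∅)) X≡∅) X≢∅
    (no X≢∅) → case nonzero-signs Y≢∅ X≢∅ of λ where
      (inj₁ Y≡X) → avoids⇒¬≤ₛ av KY (≤ₛ-at X at Y≡X)
      (inj₂ Y≡−X) → avoids⇒¬≤ₛ av⁻ KY (≤ₛ-at (neg X) (λ j → at j ∘ neg-⊑ X j) (trans Y≡−X (sym (lookup-neg X i))))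
  where
  ≤ₛ-at : ∀ W → (∀ j → supp W j → j ≡ i) → Y ⟨ i ⟩ ≡ W ⟨ i ⟩ → W ≤ₛ Y
  ≤ₛ-at W at Yi≡Wi j W≢∅ = subst (λ k → Y ⟨ k ⟩ ≡ W ⟨ k ⟩) (sym (at j W≢∅)) Yi≡Wi

nonzero : Sign → Bool
nonzero ∅ = false
nonzero _ = true

support : SignedSet N → Subset N
support = map nonzero

supp⇒∈support : ∀ X {j} → supp X j → j ∈ support {N} X
supp⇒∈support X {j} X≢∅ = Vecₚ.lookup⇒[]= j (support X) (trans (Vecₚ.lookup-map j nonzero X) (nonzero-true X≢∅))
  where
  nonzero-true : x ≢ ∅ → nonzero x ≡ true
  nonzero-true {⊕} _ = refl
  nonzero-true {⊖} _ = refl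
  nonzero-true {∅} ∅≢∅ = contradiction refl ∅≢∅

∈support⇒supp : ∀ X {j} → j ∈ support {N} X → supp X j
∈support⇒supp X {j} j∈ X≡∅ with trans (sym (Vecₚ.[]=⇒lookup j∈)) (Vecₚ.lookup-map j nonzero X)
... | eq rewrite X≡∅ = case eq of λ ()

⊏⇒support⊂ : Z ⊏ X → support Z ⊂ support X
⊏⇒support⊂ {Z = Z} {X = X} (Z⊑X , X⋢Z) = (supp⇒∈support X ∘ Z⊑X _ ∘ ∈support⇒supp Z) , witness
  where
  witness : ∃ λ j → j ∈ support X × j ∉ support Z
  witness with Finₚ.¬∀⟶∃¬ _ (λ j → supp X j → supp Z j) (λ j → supp? X j →-dec supp? Z j) X⋢Z
  ... | j , ¬X⇒Z = j , supp⇒∈support X (λ X≡∅ → ¬X⇒Z λ X≢∅ → contradiction X≡∅ X≢∅)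
                      , λ j∈Z → ¬X⇒Z λ _ → ∈support⇒supp Z j∈Z

⊏-wellFounded : WellFounded (_⊏_ {N})
⊏-wellFounded = Subrelation.wellFounded (λ {Z} {X} Z⊏X → p⊂q⇒∣p∣<∣q∣ (⊏⇒support⊂ {Z = Z} {X = X} Z⊏X))
                                        (On.wellFounded (∣_∣ ∘ support) <-wellFounded)

⊏-neg : Z ⊏ neg X → Z ⊏ X
⊏-neg {X = X} (Z⊑−X , −X⋢Z) = (λ j → neg-⊑ X j ∘ Z⊑−X j) , λ X⊑Z → −X⋢Z λ j → X⊑Z j ∘ neg-⊑ X j

-- Stated under ¬ ¬ because avoidance is not decidable.
circuit-under : Avoids K X → ¬ ¬ ∃ λ Z → IsCircuit K Z × Z ⊑ X
circuit-under {K = K} {X = X} = go X (⊏-wellFounded X)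
  where
  go : ∀ X → Acc _⊏_ X → Avoids K X → ¬ ¬ ∃ λ Z → IsCircuit K Z × Z ⊑ X
  go X (acc rs) av none = none (X , (av , minimal) , λ _ → id)
    where
    minimal : ∀ Z → Z ⊏ X → ¬ Avoids K Z
    minimal Z Z⊏X avZ = go Z (rs Z⊏X) avZ λ (W , cW , W⊑Z) → none (W , cW , λ j → proj₁ Z⊏X j ∘ W⊑Z j)

-- Y₀ makes -Z avoided along with Z (avoids-neg), so a support-minimal avoided Z ⊑ X is a circuit pair.
circuit-pair-under : IsCOM K → ∀ {Y₀} → K Y₀ → (∀ j → supp X j → Y₀ ⟨ j ⟩ ≡ ∅) → Avoids K X →
                     ¬ ¬ ∃ λ Z → IsCircuit K Z × IsCircuit K (neg Z) × NonEmptySupp Z × Z ⊑ X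
circuit-pair-under {K = K} {X = X} com {Y₀} KY₀ = go X (⊏-wellFounded X)
  where
  go : ∀ X → Acc _⊏_ X → (∀ j → supp X j → Y₀ ⟨ j ⟩ ≡ ∅) → Avoids K X →
       ¬ ¬ ∃ λ Z → IsCircuit K Z × IsCircuit K (neg Z) × NonEmptySupp Z × Z ⊑ X
  go X (acc rs) Y₀≈∅ av none =
    none (X , (av , minimal) , (avoids-neg com KY₀ Y₀≈∅ av , minimal⁻) , avoids⇒nonempty av KY₀ , λ _ → id)
    where
    minimal : ∀ Z → Z ⊏ X → ¬ Avoids K Z
    minimal Z Z⊏X@(Z⊑X , _) avZ = go Z (rs Z⊏X) (λ j → Y₀≈∅ j ∘ Z⊑X j) avZ
      λ (W , cW , cW⁻ , neW , W⊑Z) → none (W , cW , cW⁻ , neW , λ j → Z⊑X j ∘ W⊑Z j)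
    minimal⁻ : ∀ Z → Z ⊏ neg X → ¬ Avoids K Z
    minimal⁻ Z Z⊏−X = minimal Z (⊏-neg {Z = Z} {X = X} Z⊏−X)

circuit-free⇒independent : ∀ {U} → (∀ Z → IsCircuit K Z → ¬ supp Z ⊆′ U) → Independent K U
circuit-free⇒independent free ρ ρ⊆U avρ =
  circuit-under avρ λ (Z , cZ , Z⊑ρ) → free Z cZ λ j → ρ⊆U j ∘ Z⊑ρ j

-- Realizing sign patterns on an independent set

AgreeOn : Pred (Fin N) 0ℓ → SignedSet N → SignedSet N → Set
AgreeOn U V σ = ∀ j → U j → V ⟨ j ⟩ ≡ σ ⟨ j ⟩

agree⇒≤ₛ : ∀ {U W Q} → AgreeOn {N} U W Q → supp Q ⊆′ U → Q ≤ₛ W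
agree⇒≤ₛ W≈Q Q⊆U j Q≢∅ = W≈Q j (Q⊆U j Q≢∅)

module Realization (com : IsCOM K) {U : Pred (Fin N) 0ℓ} (U? : Decidable U) (indep : Independent K U) where

  -- Induction on a list containing the zeros of σ in U: a zero at j₀ is obtained by eliminating
  -- j₀ between realizations of σ with j₀ set to ⊕ and to ⊖.
  realize : ∀ σ → supp σ ⊆′ U → ¬ ¬ ∃ λ V → K V × AgreeOn U V σ
  realize σ σ⊆U = go (allFin _) σ σ⊆U (λ j _ _ → ∈-allFin j)
    where
    go : ∀ js σ → supp σ ⊆′ U → (∀ j → U j → σ ⟨ j ⟩ ≡ ∅ → j ∈ˡ js) → ¬ ¬ ∃ λ V → K V × AgreeOn U V σ
    go [] σ σ⊆U zeros = do
      V , KV , σ≤V ← ¬avoids⇒covered (indep σ σ⊆U)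
      pure (V , KV , λ j uj → σ≤V j λ σ≡∅ → case zeros j uj σ≡∅ of λ ())
    go (j₀ ∷ js) σ σ⊆U zeros with U? j₀ ×-dec σ ⟨ j₀ ⟩ ≟ₛ ∅
    ... | no ¬zero₀ = go js σ σ⊆U λ j uj σ≡∅ →
      Any.tail (λ { refl → ¬zero₀ (uj , σ≡∅) }) (zeros j uj σ≡∅)
    ... | yes (u₀ , σ₀≡∅) = do
      V₁ , K₁ , V₁≈ ← go js (σ [ j₀ ]≔ ⊕) (set-supp ⊕) (set-zeros ⊕ λ ())
      V₂ , K₂ , V₂≈ ← go js (σ [ j₀ ]≔ ⊖) (set-supp ⊖) (set-zeros ⊖ λ ())
      let Z , KZ , Z₀≡∅ , Z≈V₁ = elimination com K₁ K₂
                                   (subst₂ Opposite (sym (set-at V₁ ⊕ V₁≈)) (sym (set-at V₂ ⊖ V₂≈)) (refl , λ ()))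
      pure (Z , KZ , λ j uj → case j Finₚ.≟ j₀ of λ where
        (yes refl) → trans Z₀≡∅ (sym σ₀≡∅)
        (no j≢j₀) → trans (Z≈V₁ j (trans (set-off V₁ ⊕ V₁≈ uj j≢j₀) (sym (set-off V₂ ⊖ V₂≈ uj j≢j₀))))
                          (set-off V₁ ⊕ V₁≈ uj j≢j₀))
      where
      set-supp : ∀ s → supp (σ [ j₀ ]≔ s) ⊆′ U
      set-supp s j σ′≢∅ with j Finₚ.≟ j₀
      ... | yes refl = u₀
      ... | no j≢j₀ = σ⊆U j (subst (_≢ ∅) (Vecₚ.lookup∘update′ j≢j₀ σ s) σ′≢∅)
      set-zeros : ∀ s → s ≢ ∅ → ∀ j → U j → (σ [ j₀ ]≔ s) ⟨ j ⟩ ≡ ∅ → j ∈ˡ js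
      set-zeros s s≢∅ j uj σ′≡∅ with j Finₚ.≟ j₀
      ... | yes refl = contradiction (trans (sym (Vecₚ.lookup∘update j₀ σ s)) σ′≡∅) s≢∅
      ... | no j≢j₀ = Any.tail j≢j₀ (zeros j uj (trans (sym (Vecₚ.lookup∘update′ j≢j₀ σ s)) σ′≡∅))
      set-at : ∀ V s → AgreeOn U V (σ [ j₀ ]≔ s) → V ⟨ j₀ ⟩ ≡ s
      set-at V s V≈ = trans (V≈ j₀ u₀) (Vecₚ.lookup∘update j₀ σ s)
      set-off : ∀ V s → AgreeOn U V (σ [ j₀ ]≔ s) → ∀ {j} → U j → j ≢ j₀ → V ⟨ j ⟩ ≡ σ ⟨ j ⟩
      set-off V s V≈ uj j≢j₀ = trans (V≈ _ uj) (Vecₚ.lookup∘update′ j≢j₀ σ s)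

  restrict : SignedSet N → SignedSet N
  restrict Q = Vec.tabulate λ j → if does (U? j) then Q ⟨ j ⟩ else ∅

  restrict-agrees : ∀ Q → AgreeOn U (restrict Q) Q
  restrict-agrees Q j uj rewrite Vecₚ.lookup∘tabulate (λ j → if does (U? j) then Q ⟨ j ⟩ else ∅) j with U? j
  ... | yes _ = refl
  ... | no ¬uj = contradiction uj ¬uj

  supp-restrict : ∀ Q → supp (restrict Q) ⊆′ U
  supp-restrict Q j Q′≢∅ rewrite Vecₚ.lookup∘tabulate (λ j → if does (U? j) then Q ⟨ j ⟩ else ∅) j with U? j
  ... | yes uj = uj
  ... | no _ = contradiction refl Q′≢∅

  -- W = Y₀ ∘ Y₁ for a realization Y₁ of Q restricted to U.
  realize-through : ∀ {Y₀ m} → K Y₀ → (∀ j → U j → Y₀ ⟨ j ⟩ ≡ ∅) → supp Y₀ m →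
                    ∀ Q → Q ⟨ m ⟩ ≡ Y₀ ⟨ m ⟩ → ¬ ¬ ∃ λ W → K W × AgreeOn U W Q × W ⟨ m ⟩ ≡ Q ⟨ m ⟩
  realize-through {Y₀} {m} KY₀ Y₀≈∅ Y₀≢∅ Q Qm≡Y₀m = do
    Y₁ , KY₁ , Y₁≈ ← realize (restrict Q) (supp-restrict Q)
    pure (Y₀ ∘ₛ Y₁ , ∘ₛ-closed com KY₀ KY₁ , on-U Y₁ Y₁≈ , at-m Y₁)
    where
    on-U : ∀ Y₁ → AgreeOn U Y₁ (restrict Q) → AgreeOn U (Y₀ ∘ₛ Y₁) Q
    on-U Y₁ Y₁≈ j uj = begin
      (Y₀ ∘ₛ Y₁) ⟨ j ⟩              ≡⟨ lookup-∘ₛ Y₀ Y₁ j ⟩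
      compS (Y₀ ⟨ j ⟩) (Y₁ ⟨ j ⟩)   ≡⟨ cong (λ y → compS y (Y₁ ⟨ j ⟩)) (Y₀≈∅ j uj) ⟩
      Y₁ ⟨ j ⟩                      ≡⟨ Y₁≈ j uj ⟩
      restrict Q ⟨ j ⟩              ≡⟨ restrict-agrees Q j uj ⟩
      Q ⟨ j ⟩                       ∎
      where open ≡-Reasoning
    at-m : ∀ Y₁ → (Y₀ ∘ₛ Y₁) ⟨ m ⟩ ≡ Q ⟨ m ⟩
    at-m Y₁ = trans (lookup-∘ₛ Y₀ Y₁ m) (trans (compS-≢∅ Y₀≢∅) (sym Qm≡Y₀m))

-- Broken circuits and the least element of a support

MinSupp : SignedSet N → Fin N → Set
MinSupp X m = supp X m × (∀ k → k < m → ¬ supp X k)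

min-supp : NonEmptySupp X → ∃ (MinSupp X)
min-supp {X = X} (j , Xj≢∅)
  with Finₚ.¬∀⟶∃¬-smallest _ (λ k → X ⟨ k ⟩ ≡ ∅) (λ k → X ⟨ k ⟩ ≟ₛ ∅) (λ X≡∅ → Xj≢∅ (X≡∅ j))
... | m , Xm≢∅ , below = m , Xm≢∅ , λ k k<m Xk≢∅ →
  Xk≢∅ (subst (λ i → X ⟨ i ⟩ ≡ ∅) (inject-fromℕ< k<m) (below (fromℕ< k<m)))
  where
  inject-fromℕ< : ∀ {k} (k<m : k < m) → inject (fromℕ< k<m) ≡ k
  inject-fromℕ< k<m = Finₚ.toℕ-injective (trans (Finₚ.toℕ-inject (fromℕ< k<m)) (Finₚ.toℕ-fromℕ< k<m))

ring⇒supp-min⊆ : ∀ {S m} → RingIn X S → MinSupp X m → ∀ j → supp X j → j ≢ m → j ∈ S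
ring⇒supp-min⊆ ring (Xm≢∅ , least) j Xj≢∅ j≢m =
  ring j Xj≢∅ (_ , Finₚ.≤∧≢⇒< (ℕₚ.≮⇒≥ λ j<m → least j j<m Xj≢∅) (j≢m ∘ sym) , Xm≢∅)

⊑-ring-≢-min : ∀ {m} → MinSupp X m → Z ⊑ X → ∀ {j k} → supp Z k → k < j → j ≢ m
⊑-ring-≢-min (_ , least) Z⊑X Zk≢∅ k<j refl = least _ k<j (Z⊑X _ Zk≢∅)

-- X̊ is independent, so some covector Y₀ vanishes on it. If Y₀ also vanishes at min X, a
-- support-minimal avoided Z ⊑ X would be a circuit pair with broken circuit inside X̊ ⊆ S;
-- otherwise Y₀ fixes the sign at min X.
nbc-dichotomy : IsCOM K → ∀ {S} → IsNBC K S → ∀ {X m} → MinSupp X m → RingIn X S →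
                ¬ ¬ ((∀ Z → Z ⊑ X → ¬ Avoids K Z)
                    ⊎ ∃ λ c → c ≢ ∅ × ∀ Q → Q ⟨ m ⟩ ≡ c → ¬ ¬ ∃ λ W → K W × AgreeOn (supp X) W Q)
nbc-dichotomy {K = K} com {S} (no-circuit , no-broken) {X} {m} X-min ring = do
  Y₀ , KY₀ , Y₀≈∅ ← realize (Vec.replicate _ ∅) (λ j ∅≢∅ → contradiction (Vecₚ.lookup-replicate j ∅) ∅≢∅)
  let Y₀-vanishes : ∀ j → U j → Y₀ ⟨ j ⟩ ≡ ∅
      Y₀-vanishes j uj = trans (Y₀≈∅ j uj) (Vecₚ.lookup-replicate j ∅)
  pure (case Y₀ ⟨ m ⟩ ≟ₛ ∅ of λ where
    (yes Y₀m≡∅) → inj₁ (all-covered KY₀ λ j Xj≢∅ → case j Finₚ.≟ m of λ where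
                    (yes refl) → Y₀m≡∅
                    (no j≢m) → Y₀-vanishes j (Xj≢∅ , j≢m))
    (no Y₀m≢∅) → inj₂ (Y₀ ⟨ m ⟩ , Y₀m≢∅ , λ Q Qm≡ →
                    ¬¬-map (λ (W , KW , W≈Q , Wm≡Qm) → W , KW , λ j Xj≢∅ → case j Finₚ.≟ m of λ where
                             (yes refl) → Wm≡Qm
                             (no j≢m) → W≈Q j (Xj≢∅ , j≢m))
                           (realize-through KY₀ Y₀-vanishes Y₀m≢∅ Q Qm≡)))
  where
  U : Pred (Fin _) 0ℓ
  U j = supp X j × j ≢ m
  U⊆S : ∀ j → U j → j ∈ S
  U⊆S j (Xj≢∅ , j≢m) = ring⇒supp-min⊆ {X = X} ring X-min j Xj≢∅ j≢m
  open Realization com (λ j → supp? X j ×-dec ¬? (j Finₚ.≟ m))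
                       (circuit-free⇒independent λ Z cZ Z⊆U → no-circuit Z cZ λ j → U⊆S j ∘ Z⊆U j)
  all-covered : ∀ {Y₀} → K Y₀ → (∀ j → supp X j → Y₀ ⟨ j ⟩ ≡ ∅) → ∀ Z → Z ⊑ X → ¬ Avoids K Z
  all-covered KY₀ Y₀≈∅ Z Z⊑X avZ =
    circuit-pair-under com KY₀ (λ j → Y₀≈∅ j ∘ Z⊑X j) avZ λ (W , cW , cW⁻ , neW , W⊑Z) →
      no-broken W cW cW⁻ neW λ j Wj≢∅ (k , k<j , Wk≢∅) →
        U⊆S j (Z⊑X j (W⊑Z j Wj≢∅) , ⊑-ring-≢-min {X = X} {Z = W} X-min (λ i → Z⊑X i ∘ W⊑Z i) Wk≢∅ k<j)

∷ʳ-elim : ∀ {n} {P : Vec A (suc n) → Set} → (∀ xs x → P (xs ∷ʳ x)) → ∀ xs → P xs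
∷ʳ-elim h xs with Vec.initLast xs
... | ys , y , refl = h ys y

π-∷ʳ : ∀ {n} (xs : Vec A n) x → π (xs ∷ʳ x) ≡ xs
π-∷ʳ [] x = refl
π-∷ʳ (y ∷ xs) x = cong (y ∷_) (π-∷ʳ xs x)

lookup-∷ʳ-inject₁ : ∀ {n} (xs : Vec A n) x j → lookup (xs ∷ʳ x) (inject₁ j) ≡ lookup xs j
lookup-∷ʳ-inject₁ (y ∷ xs) x Fin.zero = refl
lookup-∷ʳ-inject₁ (y ∷ xs) x (Fin.suc j) = lookup-∷ʳ-inject₁ xs x j

lookup-∷ʳ-fromℕ : ∀ {n} (xs : Vec A n) x → lookup (xs ∷ʳ x) (fromℕ n) ≡ x
lookup-∷ʳ-fromℕ [] x = refl
lookup-∷ʳ-fromℕ (y ∷ xs) x = lookup-∷ʳ-fromℕ xs x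

pointwise-∷ʳ : ∀ {n} (R : A → B → Set) (xs : Vec A n) (ys : Vec B n) x y →
               (∀ k → R (lookup (xs ∷ʳ x) k) (lookup (ys ∷ʳ y) k))
               ⇔ ((∀ j → R (lookup xs j) (lookup ys j)) × R x y)
pointwise-∷ʳ {n = n} R xs ys x y = mk⇔
  (λ h → (λ j → subst₂ R (lookup-∷ʳ-inject₁ xs x j) (lookup-∷ʳ-inject₁ ys y j) (h (inject₁ j)))
       , subst₂ R (lookup-∷ʳ-fromℕ xs x) (lookup-∷ʳ-fromℕ ys y) (h (fromℕ n)))
  (λ (h , r) k → at k (Top.view k) h r)
  where
  at : ∀ k → Top.View k → (∀ j → R (lookup xs j) (lookup ys j)) → R x y → R (lookup (xs ∷ʳ x) k) (lookup (ys ∷ʳ y) k)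
  at _ Top.‵fromℕ _ r = subst₂ R (sym (lookup-∷ʳ-fromℕ xs x)) (sym (lookup-∷ʳ-fromℕ ys y)) r
  at _ (Top.‵inject₁ j) h _ = subst₂ R (sym (lookup-∷ʳ-inject₁ xs x j)) (sym (lookup-∷ʳ-inject₁ ys y j)) (h j)

lastSign-∷ʳ : ∀ {n} (X : SignedSet n) x → lastSign (X ∷ʳ x) ≡ x
lastSign-∷ʳ [] x = refl
lastSign-∷ʳ (y ∷ X) x = lastSign-∷ʳ X x

neg-∷ʳ : ∀ {n} (X : SignedSet n) x → neg (X ∷ʳ x) ≡ neg X ∷ʳ negS x
neg-∷ʳ X x = Vecₚ.map-∷ʳ negS x X

∘ₛ-∷ʳ : ∀ {n} (X Y : SignedSet n) x y → (X ∷ʳ x) ∘ₛ (Y ∷ʳ y) ≡ (X ∘ₛ Y) ∷ʳ compS x y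
∘ₛ-∷ʳ [] [] x y = refl
∘ₛ-∷ʳ (x′ ∷ X) (y′ ∷ Y) x y = cong (compS x′ y′ ∷_) (∘ₛ-∷ʳ X Y x y)

module _ {n} (X Y : SignedSet n) (x y : Sign) where

  ≤ₛ-∷ʳ : (X ∷ʳ x) ≤ₛ (Y ∷ʳ y) ⇔ (X ≤ₛ Y × (x ≢ ∅ → y ≡ x))
  ≤ₛ-∷ʳ = pointwise-∷ʳ (λ a b → a ≢ ∅ → b ≡ a) X Y x y

  ⊑-∷ʳ : (X ∷ʳ x) ⊑ (Y ∷ʳ y) ⇔ (X ⊑ Y × (x ≢ ∅ → y ≢ ∅))
  ⊑-∷ʳ = pointwise-∷ʳ (λ a b → a ≢ ∅ → b ≢ ∅) X Y x y

module _ {n} (X : SignedSet n) (x : Sign) where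

  supp-∷ʳ-inject₁ : ∀ {j} → supp (X ∷ʳ x) (inject₁ j) ⇔ supp X j
  supp-∷ʳ-inject₁ {j} = mk⇔ (subst (_≢ ∅) (lookup-∷ʳ-inject₁ X x j)) (subst (_≢ ∅) (sym (lookup-∷ʳ-inject₁ X x j)))

  supp-∷ʳ-fromℕ : supp (X ∷ʳ x) (fromℕ n) ⇔ (x ≢ ∅)
  supp-∷ʳ-fromℕ = mk⇔ (subst (_≢ ∅) (lookup-∷ʳ-fromℕ X x)) (subst (_≢ ∅) (sym (lookup-∷ʳ-fromℕ X x)))

module _ {n} (S : Subset n) (b : Bool) where

  ∈-∷ʳ-inject₁ : ∀ {j} → inject₁ j ∈ (S ∷ʳ b) ⇔ j ∈ S
  ∈-∷ʳ-inject₁ {j} = mk⇔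
    (λ j∈ → Vecₚ.lookup⇒[]= j S (trans (sym (lookup-∷ʳ-inject₁ S b j)) (Vecₚ.[]=⇒lookup j∈)))
    (λ j∈ → Vecₚ.lookup⇒[]= (inject₁ j) (S ∷ʳ b) (trans (lookup-∷ʳ-inject₁ S b j) (Vecₚ.[]=⇒lookup j∈)))

  fromℕ-∈-∷ʳ : fromℕ n ∈ (S ∷ʳ b) ⇔ (b ≡ true)
  fromℕ-∈-∷ʳ = mk⇔
    (λ top∈ → trans (sym (lookup-∷ʳ-fromℕ S b)) (Vecₚ.[]=⇒lookup top∈))
    (λ b≡true → Vecₚ.lookup⇒[]= (fromℕ n) (S ∷ʳ b) (trans (lookup-∷ʳ-fromℕ S b) b≡true))

inject₁<fromℕ : ∀ {n} (j : Fin n) → inject₁ j < fromℕ n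
inject₁<fromℕ {n} j = subst₂ ℕ._<_ (sym (Finₚ.toℕ-inject₁ j)) (sym (Finₚ.toℕ-fromℕ n)) (Finₚ.toℕ<n j)

fromℕ≮ : ∀ {n} (k : Fin (suc n)) → ¬ fromℕ n < k
fromℕ≮ k = ℕₚ.≤⇒≯ (Finₚ.≤fromℕ k)

inject₁-<⇔ : ∀ {n} {i j : Fin n} → inject₁ i < inject₁ j ⇔ i < j
inject₁-<⇔ {i = i} {j} = mk⇔ (subst₂ ℕ._<_ (Finₚ.toℕ-inject₁ i) (Finₚ.toℕ-inject₁ j))
                             (subst₂ ℕ._<_ (sym (Finₚ.toℕ-inject₁ i)) (sym (Finₚ.toℕ-inject₁ j)))

module _ {n} (X : SignedSet n) (x : Sign) (S : Subset n) (b : Bool) where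

  SuppIn-∷ʳ : SuppIn (X ∷ʳ x) (S ∷ʳ b) ⇔ (SuppIn X S × (x ≢ ∅ → b ≡ true))
  SuppIn-∷ʳ = mk⇔
    (λ h → (λ j → to (∈-∷ʳ-inject₁ S b) ∘ h (inject₁ j) ∘ from (supp-∷ʳ-inject₁ X x))
         , to (fromℕ-∈-∷ʳ S b) ∘ h (fromℕ n) ∘ from (supp-∷ʳ-fromℕ X x))
    (λ (h , h-top) k → at k (Top.view k) h h-top)
    where
    at : ∀ k → Top.View k → SuppIn X S → (x ≢ ∅ → b ≡ true) → supp (X ∷ʳ x) k → k ∈ (S ∷ʳ b)
    at _ Top.‵fromℕ _ h-top = from (fromℕ-∈-∷ʳ S b) ∘ h-top ∘ to (supp-∷ʳ-fromℕ X x)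
    at _ (Top.‵inject₁ j) h _ = from (∈-∷ʳ-inject₁ S b) ∘ h j ∘ to (supp-∷ʳ-inject₁ X x)

  RingIn-∷ʳ : RingIn (X ∷ʳ x) (S ∷ʳ b) ⇔ (RingIn X S × (x ≢ ∅ → NonEmptySupp X → b ≡ true))
  RingIn-∷ʳ = mk⇔
    (λ ring → (λ j Xj≢∅ (k , k<j , Xk≢∅) → to (∈-∷ʳ-inject₁ S b)
                 (ring (inject₁ j) (from (supp-∷ʳ-inject₁ X x) Xj≢∅)
                       (inject₁ k , from inject₁-<⇔ k<j , from (supp-∷ʳ-inject₁ X x) Xk≢∅)))
            , λ x≢∅ (j , Xj≢∅) → to (fromℕ-∈-∷ʳ S b)
                 (ring (fromℕ n) (from (supp-∷ʳ-fromℕ X x) x≢∅)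
                       (inject₁ j , inject₁<fromℕ j , from (supp-∷ʳ-inject₁ X x) Xj≢∅)))
    (λ (ring , top) k Xk≢∅ (k₀ , k₀<k , Xk₀≢∅) → at k k₀ (Top.view k) (Top.view k₀) ring top Xk≢∅ k₀<k Xk₀≢∅)
    where
    at : ∀ k k₀ → Top.View k → Top.View k₀ → RingIn X S → (x ≢ ∅ → NonEmptySupp X → b ≡ true) →
         supp (X ∷ʳ x) k → k₀ < k → supp (X ∷ʳ x) k₀ → k ∈ (S ∷ʳ b)
    at k _ _ Top.‵fromℕ _ _ _ k₀<k _ = contradiction k₀<k (fromℕ≮ k)
    at _ _ Top.‵fromℕ (Top.‵inject₁ j₀) _ top Xk≢∅ _ Xk₀≢∅ =
      from (fromℕ-∈-∷ʳ S b) (top (to (supp-∷ʳ-fromℕ X x) Xk≢∅) (j₀ , to (supp-∷ʳ-inject₁ X x) Xk₀≢∅))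
    at _ _ (Top.‵inject₁ j) (Top.‵inject₁ j₀) ring _ Xk≢∅ k₀<k Xk₀≢∅ =
      from (∈-∷ʳ-inject₁ S b)
        (ring j (to (supp-∷ʳ-inject₁ X x) Xk≢∅) (j₀ , to inject₁-<⇔ k₀<k , to (supp-∷ʳ-inject₁ X x) Xk₀≢∅))

⊏-∷ʳ∅ : ∀ {n} (Z X : SignedSet n) → (Z ∷ʳ ∅) ⊏ (X ∷ʳ ∅) ⇔ Z ⊏ X
⊏-∷ʳ∅ Z X = mk⇔
  (λ (Z⊑X , X⋢Z) → proj₁ (to (⊑-∷ʳ Z X ∅ ∅) Z⊑X) , λ X⊑Z → X⋢Z (from (⊑-∷ʳ X Z ∅ ∅) (X⊑Z , id)))
  (λ (Z⊑X , X⋢Z) → from (⊑-∷ʳ Z X ∅ ∅) (Z⊑X , id) , λ X⊑Z → X⋢Z (proj₁ (to (⊑-∷ʳ X Z ∅ ∅) X⊑Z)))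

∅≢∅-elim : ∀ {P : Set} → ∅ ≢ ∅ → P
∅≢∅-elim ∅≢∅ = contradiction refl ∅≢∅

≡∅-stable : ∀ x → ¬ x ≢ ∅ → x ≡ ∅
≡∅-stable x = decidable-stable (x ≟ₛ ∅)

avoided-pair-init-nonempty : ∀ {n} {L : Family (suc n)} {X x} → ¬ IsColoop L (fromℕ n) →
                             Avoids L (X ∷ʳ x) → Avoids L (neg (X ∷ʳ x)) → NonEmptySupp X
avoided-pair-init-nonempty {n} {X = X} {x} ¬coloop av av⁻ with Finₚ.any? (supp? X)
... | yes nonempty = nonempty
... | no empty = contradiction (avoided-pair-at⇒coloop av av⁻ λ k → at k (Top.view k)) ¬coloop
  where
  at : ∀ k → Top.View k → supp (X ∷ʳ x) k → k ≡ fromℕ n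
  at _ Top.‵fromℕ _ = refl
  at _ (Top.‵inject₁ j) Xj≢∅ = contradiction (j , to (supp-∷ʳ-inject₁ X x) Xj≢∅) empty

MinSupp-∷ʳ : ∀ {n} {X : SignedSet n} {m} x → MinSupp X m → MinSupp (X ∷ʳ x) (inject₁ m)
MinSupp-∷ʳ {X = X} {m} x (Xm≢∅ , least) = from (supp-∷ʳ-inject₁ X x) Xm≢∅ , λ k → below k (Top.view k)
  where
  below : ∀ k → Top.View k → k < inject₁ m → ¬ supp (X ∷ʳ x) k
  below _ Top.‵fromℕ top<m = contradiction top<m (fromℕ≮ (inject₁ m))
  below _ (Top.‵inject₁ j) j<m = least j (to inject₁-<⇔ j<m) ∘ to (supp-∷ʳ-inject₁ X x)

-- Deletion

module Deletion {n} (L : Family (suc n)) where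

  deletion-∷ʳ : ∀ {X} → deletion L X ⇔ ∃ λ x → L (X ∷ʳ x)
  deletion-∷ʳ {X} = mk⇔ (λ (Y , LY , πY≡X) → restrict Y LY πY≡X) (λ (x , LX) → X ∷ʳ x , LX , π-∷ʳ X x)
    where
    restrict : ∀ Y → L Y → π Y ≡ X → ∃ λ x → L (X ∷ʳ x)
    restrict = ∷ʳ-elim λ Y y LY πY≡X → y , subst (λ V → L (V ∷ʳ y)) (trans (sym (π-∷ʳ Y y)) πY≡X) LY

  avoids-∷ʳ∅ : ∀ {X} → Avoids L (X ∷ʳ ∅) ⇔ Avoids (deletion L) X
  avoids-∷ʳ∅ {X} = mk⇔
    (λ av → ¬≤ₛ⇒avoids λ Y L′Y X≤Y → let y , LY = to deletion-∷ʳ L′Y in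
      avoids⇒¬≤ₛ av LY (from (≤ₛ-∷ʳ X Y ∅ y) (X≤Y , ∅≢∅-elim)))
    (λ av′ → ¬≤ₛ⇒avoids (∷ʳ-elim λ Y y LY X∅≤Y →
      avoids⇒¬≤ₛ av′ (from deletion-∷ʳ (y , LY)) (proj₁ (to (≤ₛ-∷ʳ X Y ∅ y) X∅≤Y))))

  circuit-∷ʳ∅ : ∀ {X} → IsCircuit L (X ∷ʳ ∅) ⇔ IsCircuit (deletion L) X
  circuit-∷ʳ∅ {X} = mk⇔
    (λ (av , minimal) → to avoids-∷ʳ∅ av , λ Z Z⊏X avZ → minimal (Z ∷ʳ ∅) (from (⊏-∷ʳ∅ Z X) Z⊏X) (from avoids-∷ʳ∅ avZ))
    (λ (av , minimal) → from avoids-∷ʳ∅ av , ∷ʳ-elim (minimal∷ʳ minimal))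
    where
    minimal∷ʳ : (∀ Z → Z ⊏ X → ¬ Avoids (deletion L) Z) → ∀ Z z → (Z ∷ʳ z) ⊏ (X ∷ʳ ∅) → ¬ Avoids L (Z ∷ʳ z)
    minimal∷ʳ minimal Z z Z⊏X with ≡∅-stable z (λ z≢∅ → proj₂ (to (⊑-∷ʳ Z X z ∅) (proj₁ Z⊏X)) z≢∅ refl)
    ... | refl = minimal Z (to (⊏-∷ʳ∅ Z X) Z⊏X) ∘ to avoids-∷ʳ∅

  nbc-deletion : ¬ IsColoop L (fromℕ n) → ∀ S → IsNBC (deletion L) S ⇔ IsNBC L (S ∷ʳ false)
  nbc-deletion ¬coloop S = mk⇔
    (λ (no-circuit , no-broken) → ∷ʳ-elim (lift-no-circuit no-circuit) , ∷ʳ-elim (lift-no-broken no-broken))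
    (λ (no-circuit , no-broken) →
       (λ X cX X⊆S → no-circuit (X ∷ʳ ∅) (from circuit-∷ʳ∅ cX)
                                (from (SuppIn-∷ʳ X ∅ S false) (X⊆S , ∅≢∅-elim)))
     , λ X cX cX⁻ (j , Xj≢∅) ring →
         no-broken (X ∷ʳ ∅) (from circuit-∷ʳ∅ cX) (subst (IsCircuit L) (sym (neg-∷ʳ X ∅)) (from circuit-∷ʳ∅ cX⁻))
                   (inject₁ j , from (supp-∷ʳ-inject₁ X ∅) Xj≢∅)
                   (from (RingIn-∷ʳ X ∅ S false) (ring , ∅≢∅-elim)))
    where
    lift-no-circuit : (∀ X → IsCircuit (deletion L) X → ¬ SuppIn X S) →
                      ∀ X x → IsCircuit L (X ∷ʳ x) → ¬ SuppIn (X ∷ʳ x) (S ∷ʳ false)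
    lift-no-circuit no-circuit X x cX X⊆S
      with ≡∅-stable x (λ x≢∅ → case proj₂ (to (SuppIn-∷ʳ X x S false) X⊆S) x≢∅ of λ ())
    ... | refl = no-circuit X (to circuit-∷ʳ∅ cX) (proj₁ (to (SuppIn-∷ʳ X x S false) X⊆S))
    lift-no-broken : (∀ X → IsCircuit (deletion L) X → IsCircuit (deletion L) (neg X) → NonEmptySupp X → ¬ RingIn X S) →
                     ∀ X x → IsCircuit L (X ∷ʳ x) → IsCircuit L (neg (X ∷ʳ x)) → NonEmptySupp (X ∷ʳ x) →
                     ¬ RingIn (X ∷ʳ x) (S ∷ʳ false)
    lift-no-broken no-broken X x cX cX⁻ _ ring
      with ne ← avoided-pair-init-nonempty ¬coloop (proj₁ cX) (proj₁ cX⁻)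
      with ≡∅-stable x (λ x≢∅ → case proj₂ (to (RingIn-∷ʳ X x S false) ring) x≢∅ ne of λ ())
    ... | refl = no-broken X (to circuit-∷ʳ∅ cX) (to circuit-∷ʳ∅ (subst (IsCircuit L) (neg-∷ʳ X ∅) cX⁻)) ne
                           (proj₁ (to (RingIn-∷ʳ X x S false) ring))

-- Contraction

module Contraction {n} (L : Family (suc n)) (com : IsCOM L) where

  contraction-∷ʳ : ∀ {X} → contraction L X ⇔ L (X ∷ʳ ∅)
  contraction-∷ʳ {X} = mk⇔ (λ (Y , LY , lastY≡∅ , πY≡X) → restrict Y LY lastY≡∅ πY≡X)
                           (λ LX → X ∷ʳ ∅ , LX , lastSign-∷ʳ X ∅ , π-∷ʳ X ∅)
    where
    restrict : ∀ Y → L Y → lastSign Y ≡ ∅ → π Y ≡ X → L (X ∷ʳ ∅)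
    restrict = ∷ʳ-elim λ Y y LY y≡∅ πY≡X →
      subst₂ (λ V v → L (V ∷ʳ v)) (trans (sym (π-∷ʳ Y y)) πY≡X) (trans (sym (lastSign-∷ʳ Y y)) y≡∅) LY

  contraction-COM : IsCOM (contraction L)
  contraction-COM = record { FS = FS″ ; SE = SE″ }
    where
    FS″ : ∀ X Y → contraction L X → contraction L Y → contraction L (X ∘ₛ neg Y)
    FS″ X Y L″X L″Y =
      from contraction-∷ʳ (subst L lower-∘ₛ (IsCOM.FS com _ _ (to contraction-∷ʳ L″X) (to contraction-∷ʳ L″Y)))
      where
      lower-∘ₛ : (X ∷ʳ ∅) ∘ₛ neg (Y ∷ʳ ∅) ≡ (X ∘ₛ neg Y) ∷ʳ ∅
      lower-∘ₛ = trans (cong ((X ∷ʳ ∅) ∘ₛ_) (neg-∷ʳ Y ∅)) (∘ₛ-∷ʳ X (neg Y) ∅ ∅)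
    SE″ : ∀ X Y → contraction L X → contraction L Y → ∀ j → InSep X Y j →
          Σ (SignedSet n) λ Z → contraction L Z × (Z ⟨ j ⟩ ≡ ∅) × (∀ k → ¬ InSep X Y k → Z ⟨ k ⟩ ≡ (X ∘ₛ Y) ⟨ k ⟩)
    SE″ X Y L″X L″Y j sep = lower (IsCOM.SE com (X ∷ʳ ∅) (Y ∷ʳ ∅) (to contraction-∷ʳ L″X) (to contraction-∷ʳ L″Y)
                                     (inject₁ j) (subst₂ Opposite (sym (at X j)) (sym (at Y j)) sep))
      where
      at : ∀ V k → (V ∷ʳ ∅) ⟨ inject₁ k ⟩ ≡ V ⟨ k ⟩
      at V = lookup-∷ʳ-inject₁ V ∅
      X∘Y-at : ∀ k → ((X ∷ʳ ∅) ∘ₛ (Y ∷ʳ ∅)) ⟨ k ⟩ ≡ ((X ∘ₛ Y) ∷ʳ ∅) ⟨ k ⟩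
      X∘Y-at k = cong (λ V → V ⟨ k ⟩) (∘ₛ-∷ʳ X Y ∅ ∅)
      lower : (Σ (SignedSet (suc n)) λ Z → L Z × (Z ⟨ inject₁ j ⟩ ≡ ∅) ×
                (∀ k → ¬ InSep (X ∷ʳ ∅) (Y ∷ʳ ∅) k → Z ⟨ k ⟩ ≡ ((X ∷ʳ ∅) ∘ₛ (Y ∷ʳ ∅)) ⟨ k ⟩)) →
              Σ (SignedSet n) λ Z → contraction L Z × (Z ⟨ j ⟩ ≡ ∅) × (∀ k → ¬ InSep X Y k → Z ⟨ k ⟩ ≡ (X ∘ₛ Y) ⟨ k ⟩)
      lower (Z , LZ , Zj≡∅ , Z≈) with Vec.initLast Z
      ... | Z′ , z , refl =
        Z′ , from contraction-∷ʳ (subst (λ v → L (Z′ ∷ʳ v)) z≡∅ LZ) , trans (sym (at′ j)) Zj≡∅ ,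
        λ k ¬sep → trans (sym (at′ k)) (trans (Z≈ (inject₁ k) (¬sep ∘ subst₂ Opposite (at X k) (at Y k)))
                                               (trans (X∘Y-at (inject₁ k)) (at (X ∘ₛ Y) k)))
        where
        at′ : ∀ k → (Z′ ∷ʳ z) ⟨ inject₁ k ⟩ ≡ Z′ ⟨ k ⟩
        at′ = lookup-∷ʳ-inject₁ Z′ z
        z≡∅ : z ≡ ∅
        z≡∅ = begin
          z                                              ≡⟨ sym (lookup-∷ʳ-fromℕ Z′ z) ⟩
          (Z′ ∷ʳ z) ⟨ fromℕ n ⟩                          ≡⟨ Z≈ (fromℕ n) (λ (_ , X≢∅) → X≢∅ (lookup-∷ʳ-fromℕ X ∅)) ⟩
          ((X ∷ʳ ∅) ∘ₛ (Y ∷ʳ ∅)) ⟨ fromℕ n ⟩              ≡⟨ X∘Y-at (fromℕ n) ⟩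
          ((X ∘ₛ Y) ∷ʳ ∅) ⟨ fromℕ n ⟩                    ≡⟨ lookup-∷ʳ-fromℕ (X ∘ₛ Y) ∅ ⟩
          ∅                                              ∎
          where open ≡-Reasoning

  -- If X ∷ʳ x is avoided but X is covered by Y ∷ʳ ∅, composing Y ∷ʳ ∅ with V or with -V for a
  -- covector V nonzero at the last coordinate produces a covector covering X ∷ʳ x.
  avoids-contraction : ¬ IsColoop L (fromℕ n) → ∀ {X x} → Avoids L (X ∷ʳ x) → Avoids (contraction L) X
  avoids-contraction ¬coloop {X} {x} av = ¬≤ₛ⇒avoids λ Y L″Y X≤Y → covered Y (to contraction-∷ʳ L″Y) X≤Y (x ≟ₛ ∅)
    where
    covered-by : ∀ Y V v → L ((Y ∷ʳ ∅) ∘ₛ (V ∷ʳ v)) → X ≤ₛ Y → v ≡ x → ⊥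
    covered-by Y V v LW X≤Y v≡x =
      avoids⇒¬≤ₛ av (subst L (∘ₛ-∷ʳ Y V ∅ v) LW)
                    (from (≤ₛ-∷ʳ X (Y ∘ₛ V) x v) (≤ₛ-∘ₛ {X = X} {Y = Y} {Z = V} X≤Y , λ _ → v≡x))
    covered : ∀ Y → L (Y ∷ʳ ∅) → X ≤ₛ Y → Dec (x ≡ ∅) → ⊥
    covered Y LY X≤Y (yes refl) = avoids⇒¬≤ₛ av LY (from (≤ₛ-∷ʳ X Y ∅ ∅) (X≤Y , ∅≢∅-elim))
    covered Y LY X≤Y (no x≢∅) = ¬coloop⇒covector ¬coloop λ (V , LV , V≢∅) →
      ∷ʳ-elim {P = λ V → L V → supp V (fromℕ n) → ⊥} through V LV V≢∅
      where
      through : ∀ V v → L (V ∷ʳ v) → supp (V ∷ʳ v) (fromℕ n) → ⊥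
      through V v LV v≢∅ with nonzero-signs x≢∅ (to (supp-∷ʳ-fromℕ V v) v≢∅)
      ... | inj₁ x≡v = covered-by Y V v (∘ₛ-closed com LY LV) X≤Y (sym x≡v)
      ... | inj₂ x≡−v = covered-by Y (neg V) (negS v)
                          (subst (λ W → L ((Y ∷ʳ ∅) ∘ₛ W)) (neg-∷ʳ V v) (IsCOM.FS com _ _ LY LV))
                          X≤Y (sym x≡−v)

  covector-∷ʳ∅⇒covered : ∀ {X} Z → L Z → Z ⟨ fromℕ n ⟩ ≡ ∅ → (∀ j → supp X j → Z ⟨ inject₁ j ⟩ ≡ X ⟨ j ⟩) →
                         ¬ Avoids (contraction L) X
  covector-∷ʳ∅⇒covered {X} = ∷ʳ-elim λ Z z LZ Zℓ≡∅ Z≈X →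
    let z≡∅ = trans (sym (lookup-∷ʳ-fromℕ Z z)) Zℓ≡∅ in
    λ av → avoids⇒¬≤ₛ av (from contraction-∷ʳ (subst (λ v → L (Z ∷ʳ v)) z≡∅ LZ))
                         λ j Xj≢∅ → trans (sym (lookup-∷ʳ-inject₁ Z z j)) (Z≈X j Xj≢∅)

  -- Eliminating the last coordinate between covectors covering X ∷ʳ ⊕ and X ∷ʳ ⊖.
  covered-both : ∀ {X} → ¬ Avoids L (X ∷ʳ ⊕) → ¬ Avoids L (X ∷ʳ ⊖) → ¬ Avoids (contraction L) X
  covered-both {X} ¬av⁺ ¬av⁻ av = ¬avoids⇒covered ¬av⁺ λ (V₁ , L₁ , X⁺≤V₁) → ¬avoids⇒covered ¬av⁻ λ (V₂ , L₂ , X⁻≤V₂) →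
    let Z , LZ , Zℓ≡∅ , Z≈V₁ = elimination com L₁ L₂
                                 (subst₂ Opposite (sym (top V₁ ⊕ X⁺≤V₁ λ ())) (sym (top V₂ ⊖ X⁻≤V₂ λ ())) (refl , λ ()))
    in covector-∷ʳ∅⇒covered Z LZ Zℓ≡∅
         (λ j Xj≢∅ → trans (Z≈V₁ (inject₁ j) (trans (off V₁ ⊕ X⁺≤V₁ Xj≢∅) (sym (off V₂ ⊖ X⁻≤V₂ Xj≢∅))))
                           (off V₁ ⊕ X⁺≤V₁ Xj≢∅))
         av
    where
    top : ∀ V s → (X ∷ʳ s) ≤ₛ V → s ≢ ∅ → V ⟨ fromℕ n ⟩ ≡ s
    top V s X≤V s≢∅ = trans (X≤V (fromℕ n) (from (supp-∷ʳ-fromℕ X s) s≢∅)) (lookup-∷ʳ-fromℕ X s)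
    off : ∀ V s {j} → (X ∷ʳ s) ≤ₛ V → supp X j → V ⟨ inject₁ j ⟩ ≡ X ⟨ j ⟩
    off V s {j} X≤V Xj≢∅ = trans (X≤V (inject₁ j) (from (supp-∷ʳ-inject₁ X s) Xj≢∅)) (lookup-∷ʳ-inject₁ X s j)

  nbc-contraction : ¬ IsColoop L (fromℕ n) → ∀ S → IsNBC (contraction L) S ⇔ IsNBC L (S ∷ʳ true)
  nbc-contraction ¬coloop S = mk⇔ lift lower
    where
    lift : IsNBC (contraction L) S → IsNBC L (S ∷ʳ true)
    lift nbc″@(no-circuit″ , _) = ∷ʳ-elim no-circuit , ∷ʳ-elim no-broken
      where
      no-circuit : ∀ X x → IsCircuit L (X ∷ʳ x) → ¬ SuppIn (X ∷ʳ x) (S ∷ʳ true)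
      no-circuit X x (av , _) X⊆S = circuit-under (avoids-contraction ¬coloop av) λ (Z , cZ , Z⊑X) →
        no-circuit″ Z cZ λ j → proj₁ (to (SuppIn-∷ʳ X x S true) X⊆S) j ∘ Z⊑X j
      no-broken : ∀ X x → IsCircuit L (X ∷ʳ x) → IsCircuit L (neg (X ∷ʳ x)) → NonEmptySupp (X ∷ʳ x) →
                  ¬ RingIn (X ∷ʳ x) (S ∷ʳ true)
      no-broken X x (av , _) (av⁻ , _) _ ring =
        with-min (min-supp {X = X} (avoided-pair-init-nonempty {X = X} {x = x} ¬coloop av av⁻))
        where
        av″ : Avoids (contraction L) X
        av″ = avoids-contraction ¬coloop av
        av″⁻ : Avoids (contraction L) (neg X)
        av″⁻ = avoids-contraction ¬coloop (subst (Avoids L) (neg-∷ʳ X x) av⁻)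
        with-min : ∃ (MinSupp X) → ⊥
        with-min (m , X-min) =
          nbc-dichotomy contraction-COM nbc″ {X = X} {m = m} X-min (proj₁ (to (RingIn-∷ʳ X x S true) ring)) λ where
            (inj₁ all-covered) → all-covered X (λ _ → id) av″
            (inj₂ (c , c≢∅ , realize)) →
              let realized : ∀ Q → Avoids (contraction L) Q → supp Q ⊆′ supp X → Q ⟨ m ⟩ ≡ c → ⊥
                  realized Q avQ Q⊆X Qm≡c = realize Q Qm≡c λ (W , L″W , W≈Q) →
                    avoids⇒¬≤ₛ avQ L″W (agree⇒≤ₛ {U = supp X} {W = W} {Q = Q} W≈Q Q⊆X)
              in [ realized X av″ (λ _ → id) , realized (neg X) av″⁻ (neg-⊑ X) ]′ (sign-choice {X = X} (proj₁ X-min) c≢∅)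
    lower : IsNBC L (S ∷ʳ true) → IsNBC (contraction L) S
    lower nbc@(no-circuit , _) = no-circuit″ , no-broken″
      where
      extension-covered : ∀ X s → SuppIn X S → ¬ Avoids L (X ∷ʳ s)
      extension-covered X s X⊆S av = circuit-under av λ (Z , cZ , Z⊑X) →
        no-circuit Z cZ λ j → from (SuppIn-∷ʳ X s S true) (X⊆S , λ _ → refl) j ∘ Z⊑X j
      no-circuit″ : ∀ X → IsCircuit (contraction L) X → ¬ SuppIn X S
      no-circuit″ X (av , _) X⊆S = covered-both (extension-covered X ⊕ X⊆S) (extension-covered X ⊖ X⊆S) av
      no-broken″ : ∀ X → IsCircuit (contraction L) X → IsCircuit (contraction L) (neg X) → NonEmptySupp X → ¬ RingIn X S
      no-broken″ X (av , _) (av⁻ , _) ne ring = with-min (min-supp {X = X} ne)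
        where
        with-min : ∃ (MinSupp X) → ⊥
        with-min (m , X-min) =
          nbc-dichotomy com nbc {X = X ∷ʳ ⊕} {m = inject₁ m} (MinSupp-∷ʳ {X = X} ⊕ X-min)
                        (from (RingIn-∷ʳ X ⊕ S true) (ring , λ _ _ → refl)) λ where
            (inj₁ all-covered) → covered-both {X = X} (all-covered (X ∷ʳ ⊕) (λ _ → id))
                                              (all-covered (X ∷ʳ ⊖) (from (⊑-∷ʳ X X ⊖ ⊕) ((λ _ → id) , λ _ ()))) av
            (inj₂ (c , c≢∅ , realize)) →
              let realized : ∀ Q → Avoids (contraction L) Q → supp Q ⊆′ supp X → Q ⟨ m ⟩ ≡ c → ⊥
                  realized Q avQ Q⊆X Qm≡c = realize (Q ∷ʳ ∅) (trans (lookup-∷ʳ-inject₁ Q ∅ m) Qm≡c) λ (W , LW , W≈) →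
                    covector-∷ʳ∅⇒covered {X = Q} W LW
                      (trans (W≈ (fromℕ n) (from (supp-∷ʳ-fromℕ X ⊕) λ ())) (lookup-∷ʳ-fromℕ Q ∅))
                      (λ j Qj≢∅ → trans (W≈ (inject₁ j) (from (supp-∷ʳ-inject₁ X ⊕) (Q⊆X j Qj≢∅)))
                                        (lookup-∷ʳ-inject₁ Q ∅ j))
                      avQ
              in [ realized X av (λ _ → id) , realized (neg X) av⁻ (neg-⊑ X) ]′ (sign-choice {X = X} (proj₁ X-min) c≢∅)

-- Splitting subsets and counts at the last element

∉-∷ʳ : ∀ {n} (S : Subset n) c → fromℕ n ∉ (S ∷ʳ c) ⇔ (c ≡ false)
∉-∷ʳ S c = mk⇔ (λ top∉ → Boolₚ.¬-not (top∉ ∘ from (fromℕ-∈-∷ʳ S c)))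
                (λ c≡false → Boolₚ.not-¬ c≡false ∘ to (fromℕ-∈-∷ʳ S c))

fibre-∷ʳ : ∀ {n} {P : Subset n → Set} {Q Last : Subset (suc n) → Set} b →
           (∀ S c → Last (S ∷ʳ c) ⇔ (c ≡ b)) → (∀ S → P S ⇔ Q (S ∷ʳ b)) →
           ∀ S → Σ (Subset n) (λ S′ → P S′ × S ≡ S′ ∷ʳ b) ⇔ (Q S × Last S)
fibre-∷ʳ {Q = Q} b last P⇔Q = ∷ʳ-elim λ S c → mk⇔
  (λ (S′ , PS′ , eq) → subst Q (sym eq) (to (P⇔Q S′) PS′) , from (last S c) (Vecₚ.∷ʳ-injectiveʳ S S′ eq))
  (λ (QS , last-c) → let c≡b = to (last S c) last-c in
     S , from (P⇔Q S) (subst (λ c → Q (S ∷ʳ c)) c≡b QS) , cong (S ∷ʳ_) c≡b)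

count-cong : ∀ {n} {P Q : Pred (Subset n) 0ℓ} (P? : Decidable P) (Q? : Decidable Q) → (∀ S → P S ⇔ Q S) →
             count P? ≡ count Q?
count-cong P? Q? P⇔Q = cong length (Listₚ.filter-≐ P? Q? ((λ {S} → to (P⇔Q S)) , (λ {S} → from (P⇔Q S))) (allSubsets _))

length-filter-pairs : ∀ {n} {P : Pred (Subset (suc n)) 0ℓ} (P? : Decidable P) (Ss : List (Subset n)) →
  length (filter P? (concatMap (λ S → (false ∷ S) ∷ (true ∷ S) ∷ []) Ss))
  ≡ length (filter (λ S → P? (false ∷ S)) Ss) + length (filter (λ S → P? (true ∷ S)) Ss)
length-filter-pairs P? [] = refl
length-filter-pairs P? (S ∷ Ss) with ih ← length-filter-pairs P? Ss | does (P? (false ∷ S))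
... | false with does (P? (true ∷ S))
...   | false = ih
...   | true = trans (cong suc ih) (sym (ℕₚ.+-suc _ _))
length-filter-pairs P? (S ∷ Ss) | true with does (P? (true ∷ S))
...   | false = cong suc ih
...   | true = cong suc (trans (cong suc ih) (sym (ℕₚ.+-suc _ _)))

count-∷ʳ : ∀ {n} {P : Pred (Subset (suc n)) 0ℓ} (P? : Decidable P) →
           count P? ≡ count (λ S → P? (S ∷ʳ false)) + count (λ S → P? (S ∷ʳ true))
-- For n = 0, S ∷ʳ b and b ∷ S only coincide after matching S with [].
count-∷ʳ {ℕ.zero} P? = trans (length-filter-pairs P? (allSubsets 0))
                               (cong₂ _+_ (count-cong (λ S → P? (false ∷ S)) (λ S → P? (S ∷ʳ false)) λ { [] → mk⇔ id id })
                                          (count-cong (λ S → P? (true ∷ S)) (λ S → P? (S ∷ʳ true)) λ { [] → mk⇔ id id }))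
count-∷ʳ {suc n} P? = begin
  count P?                                                       ≡⟨ length-filter-pairs P? (allSubsets (suc n)) ⟩
  count (λ S → P? (false ∷ S)) + count (λ S → P? (true ∷ S))     ≡⟨ cong₂ _+_ (count-∷ʳ (λ S → P? (false ∷ S)))
                                                                                (count-∷ʳ (λ S → P? (true ∷ S))) ⟩
  (c false false + c false true) + (c true false + c true true)  ≡⟨ interchange (c false false) (c false true)
                                                                                 (c true false) (c true true) ⟩
  (c false false + c true false) + (c false true + c true true)
    ≡⟨ sym (cong₂ _+_ (length-filter-pairs (λ S → P? (S ∷ʳ false)) (allSubsets n))
                      (length-filter-pairs (λ S → P? (S ∷ʳ true)) (allSubsets n))) ⟩
  count (λ S → P? (S ∷ʳ false)) + count (λ S → P? (S ∷ʳ true))   ∎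
  where
  open ≡-Reasoning
  open CommutativeSemigroupProperties ℕₚ.+-commutativeSemigroup using (interchange)
  c : Bool → Bool → ℕ
  c first last = count (λ S → P? (first ∷ (S ∷ʳ last)))

proposition4p14 : (n : ℕ) (L : Family (suc n)) → IsCOM L → ¬ IsColoop L (fromℕ n)
    → (∀ (S : Subset (suc n)) → (Σ (Subset n) (λ S′ → IsNBC (deletion L) S′ × S ≡ S′ ∷ʳ false)) ⇔ (IsNBC L S × fromℕ n ∉ S))
    × (∀ (S : Subset (suc n)) → (Σ (Subset n) (λ S″ → IsNBC (contraction L) S″ × S ≡ S″ ∷ʳ true)) ⇔ (IsNBC L S × fromℕ n ∈ S))
    × ((d : Decidable (IsNBC L)) (d′ : Decidable (IsNBC (deletion L))) (d″ : Decidable (IsNBC (contraction L)))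
       → count d ≡ count d′ + count d″)
proposition4p14 n L com ¬coloop =
    fibre-∷ʳ false ∉-∷ʳ (nbc-deletion ¬coloop)
  , fibre-∷ʳ true fromℕ-∈-∷ʳ (nbc-contraction ¬coloop)
  , λ d d′ d″ → trans (count-∷ʳ d) (sym (cong₂ _+_ (count-cong d′ _ (nbc-deletion ¬coloop))
                                                   (count-cong d″ _ (nbc-contraction ¬coloop))))
  where
  open Deletion L using (nbc-deletion)
  open Contraction L com using (nbc-contraction)
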